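{- Let $\mathbf z$ be the infinite fixed point, starting with $a$, of the morphism $h$ with $h(a)=aab$, $h(b)=b$. Define $f:\mathbb N\to\mathbb N$ by $f(i)=j$ whenever $2^{j+1}+j-2\le i\le 2^{j+2}+j-2$, and define $g$ on positive integers by $$g(n)=\begin{cases}2^t-1,& \text{if } 2^t+t-3\le n\le 2^t+t-1,\\ 2^{t+1}+t-2-n,& \text{if } 2^t+t-1\le n\le 2^{t+1}+t-3,\end{cases}$$ where $t\ge 1$ is an integer. Let $n\ge 1$. Then $\mathbf z$ has exactly $g(n)$ distinct factors of length $n$ whose longest $b$-run has length $f(n)$.
   Context: A factor of an infinite word is a finite contiguous block of it. A $b$-run of a word $w$ is a maximal occurrence of a block of consecutive $b$'s in $w$ (not extendable within $w$ by a $b$ on either side); its length is its number of $b$'s (a word with no $b$ has longest $b$-run of length $0$). -}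

module Defs where

open import Data.Nat using (ℕ; zero; suc; _+_; _∸_; _^_; _≤_; _⊔_)
open import Data.List using (List; []; _∷_; concatMap; length)
open import Data.Product using (Σ; ∃; _×_)
open import Data.Sum using (_⊎_)
open import Relation.Binary.PropositionalEquality using (_≡_)

data Letter : Set where
  a b : Letter

h : Letter → List Letter
h a = a ∷ a ∷ b ∷ []
h b = b ∷ []

hList : List Letter → List Letter
hList = concatMap h

hIter : ℕ → List Letter
hIter zero    = a ∷ []
hIter (suc k) = hList (hIter k)

-- i-th letter of a list (default a if out of range; never used below)
nth : List Letter → ℕ → Letter
nth []       _       = a
nth (x ∷ xs) zero    = x
nth (x ∷ xs) (suc i) = nth xs i

-- z = h^ω(a): the i-th letter of z is the i-th letter of h^(i+1)(a),
-- which has length ≥ 2^(i+1) > i, and h^k(a) is a prefix of h^(k+1)(a).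
z : ℕ → Letter
z i = nth (hIter (suc i)) i

block : ℕ → ℕ → List Letter
block i zero    = []
block i (suc n) = z i ∷ block (suc i) n

IsFactor : List Letter → Set
IsFactor w = ∃ λ i → block i (length w) ≡ w

-- length of the longest b-run; cur = length of the current b-run
longestRunFrom : ℕ → List Letter → ℕ
longestRunFrom cur []      = cur
longestRunFrom cur (b ∷ w) = longestRunFrom (suc cur) w
longestRunFrom cur (a ∷ w) = cur ⊔ longestRunFrom zero w

longestBRun : List Letter → ℕ
longestBRun = longestRunFrom zero

-- f(n) = j  iff  2^(j+1)+j-2 ≤ n ≤ 2^(j+2)+j-2  (written with +2 to avoid ∸)
IsF : ℕ → ℕ → Set
IsF n j = (2 ^ (j + 1) + j ≤ n + 2) × (n + 2 ≤ 2 ^ (j + 2) + j)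

IsG : ℕ → ℕ → Set
IsG n v = ∃ λ t → (1 ≤ t) ×
  (((2 ^ t + t ≤ n + 3) × (n + 3 ≤ 2 ^ t + t + 2) × (v ≡ 2 ^ t ∸ 1))
  ⊎ ((2 ^ t + t ≤ n + 1) × (n + 3 ≤ 2 ^ (t + 1) + t) × (v ≡ (2 ^ (t + 1) + t) ∸ (n + 2))))

-- Let ℓ k = |h^k(a)| = 2^(k+1) - 1.  From h^(k+1)(a) = h^k(a) h^k(a) b, the prefix of z of
-- length 2ℓ k + 1 is two copies of h^k(a) followed by b, and h^k(a) ends with a b^k.
-- For fixed j, the word b^j h^j(a) h^j(a) (the prefix of length Xlen j = j + 2ℓ j of the
-- sequence X j = b^j z) occurs in z and contains no b^(j+1).  The argument has three parts.
--  * Structure (module FactorsOfZ): for n > j, every length-n factor of z without b^(j+1) is a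
--    window of that word; by induction on k, windows inside the second copy of h^k(a) are shifted
--    back to the first, and windows across the boundary of the copies are analysed directly.
--  * Counting: that word has period ℓ j, its length-n windows starting at 0, …, ℓ j - 1 are
--    pairwise distinct when n ≥ ℓ j + j - 1, and each of them contains b^j.
--  * Arithmetic: f(n) = j places n in the range ℓ j + j - 1 ≤ n ≤ Xlen j, these ranges are
--    disjoint, and g(n) is either ℓ j or the number Xlen j - n + 1 of all windows (Count).
-- The list in lemma12 consists of the windows starting at 0, …, g(n) - 1.

module Submission where

open import Defs
open import Data.Nat using (ℕ; _≤_)
open import Data.List using (List; length)
open import Data.List.Relation.Unary.Unique.Propositional using (Unique)
open import Data.List.Membership.Propositional using (_∈_)
open import Data.Product using (Σ; _×_)
open import Function.Bundles using (_⇔_)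
open import Relation.Binary.PropositionalEquality using (_≡_)

open import Data.Nat
open import Data.Nat.Properties
open import Data.Nat.Tactic.RingSolver using (solve-∀)
open import Data.List using ([]; _∷_; _++_; applyUpTo)
open import Data.List.Properties using (length-++; concatMap-++; length-applyUpTo)
open import Data.List.Relation.Unary.Unique.Propositional.Properties using (applyUpTo⁺₁)
open import Data.List.Membership.Propositional.Properties using (∈-applyUpTo⁺; ∈-applyUpTo⁻)
open import Data.Product using (∃; _,_; proj₁)
open import Data.Sum using (_⊎_; inj₁; inj₂)
open import Data.Empty using (⊥; ⊥-elim)
open import Relation.Nullary using (¬_; Dec; yes; no)
open import Relation.Binary.Definitions using (tri<; tri≈; tri>)
open import Function.Bundles using (mk⇔)
open import Relation.Binary.PropositionalEquality
  using (refl; sym; trans; cong; cong₂; subst; subst₂; module ≡-Reasoning)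

open import Algebra.Properties.CommutativeSemigroup +-commutativeSemigroup using (x∙yz≈y∙xz)

open ≡-Reasoning

a≢b : ¬ a ≡ b
a≢b ()

m+n≡o⇒n≤o : ∀ {m n o} → m + n ≡ o → n ≤ o
m+n≡o⇒n≤o {m} {n} refl = m≤n+m n m

m+1+n≡o⇒m<o : ∀ {m n o} → m + suc n ≡ o → m < o
m+1+n≡o⇒m<o {m} refl = m<m+n m (s≤s z≤n)

split-sum : ∀ s t c d → s + t ≡ c + d → t ≤ d → ∃ λ s' → s ≡ c + s' × s' + t ≡ d
split-sum s t c d s+t≡c+d t≤d with c ≤? s
... | yes c≤s with m≤n⇒∃[o]m+o≡n c≤s
...   | s' , c+s'≡s = s' , sym c+s'≡s , +-cancelˡ-≡ c _ _ (begin
          c + (s' + t)  ≡⟨ sym (+-assoc c s' t) ⟩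
          c + s' + t    ≡⟨ cong (_+ t) c+s'≡s ⟩
          s + t         ≡⟨ s+t≡c+d ⟩
          c + d         ∎)
split-sum s t c d s+t≡c+d t≤d | no c≰s = ⊥-elim (<⇒≢ (+-mono-<-≤ (≰⇒> c≰s) t≤d) s+t≡c+d)

room-after : ∀ {i s p j n} → 1 ≤ i → i + s ≡ p → p + j ≤ n + 1 → s + j ≤ n
room-after {suc i} {s} {p} {j} {n} _ i+s≡p p+j≤n+1 =
  ≤-pred (≤-trans (s≤s (m≤n+m (s + j) i)) (≤-trans (≤-reflexive 1+i+s+j≡p+j) (≤-trans p+j≤n+1 (≤-reflexive (+-comm n 1)))))
  where
  1+i+s+j≡p+j : suc (i + (s + j)) ≡ p + j
  1+i+s+j≡p+j = trans (cong suc (sym (+-assoc i s j))) (cong (_+ j) i+s≡p)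

data Cut (j q : ℕ) : Set where
  before : ∀ t → q + suc t ≡ j → Cut j q
  beyond : ∀ r → q ≡ j + r → Cut j q

cut : ∀ j q → Cut j q
cut j q with q <? j
... | yes q<j with m≤n⇒∃[o]m+o≡n q<j
...   | t , q+1+t≡j = before t (trans (+-suc q t) q+1+t≡j)
cut j q | no q≮j with m≤n⇒∃[o]m+o≡n (≮⇒≥ q≮j)
...   | r , j+r≡q = beyond r (sym j+r≡q)

-- ℓ k = |h^k(a)| = 2^(k+1) - 1.
ℓ : ℕ → ℕ
ℓ zero    = 1
ℓ (suc k) = suc (ℓ k + ℓ k)

2^suc≡1+ℓ : ∀ k → 2 ^ suc k ≡ suc (ℓ k)
2^suc≡1+ℓ zero    = refl
2^suc≡1+ℓ (suc k) = begin
  2 * 2 ^ suc k           ≡⟨ cong (2 *_) (2^suc≡1+ℓ k) ⟩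
  2 * suc (ℓ k)           ≡⟨ cong suc (trans (cong (ℓ k +_) (+-identityʳ (suc (ℓ k)))) (+-suc (ℓ k) (ℓ k))) ⟩
  suc (suc (ℓ k + ℓ k))   ∎

ℓ-mono : ∀ {k m} → k ≤ m → ℓ k ≤ ℓ m
ℓ-mono {zero}  {zero}  _         = ≤-refl
ℓ-mono {zero}  {suc m} _         = s≤s z≤n
ℓ-mono {suc k} {suc m} (s≤s k≤m) = s≤s (+-mono-≤ (ℓ-mono k≤m) (ℓ-mono k≤m))

k<ℓk : ∀ k → k < ℓ k
k<ℓk zero    = s≤s z≤n
k<ℓk (suc k) = s≤s (≤-trans (k<ℓk k) (m≤m+n (ℓ k) (ℓ k)))

-- h^(k+1)(a) = h^k(aab) = h^k(a) h^k(a) b: the self-similarity all letter computations rest on.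
hIter-unfold : ∀ k → hIter (suc k) ≡ hIter k ++ hIter k ++ b ∷ []
hIter-unfold zero    = refl
hIter-unfold (suc k) = begin
  hList (hIter (suc k))                         ≡⟨ cong hList (hIter-unfold k) ⟩
  hList (hIter k ++ hIter k ++ b ∷ [])          ≡⟨ concatMap-++ h (hIter k) (hIter k ++ b ∷ []) ⟩
  hIter (suc k) ++ hList (hIter k ++ b ∷ [])    ≡⟨ cong (hIter (suc k) ++_) (concatMap-++ h (hIter k) (b ∷ [])) ⟩
  hIter (suc k) ++ hIter (suc k) ++ b ∷ []      ∎

length-hIter : ∀ k → length (hIter k) ≡ ℓ k
length-hIter zero    = refl
length-hIter (suc k) = begin
  length (hIter (suc k))                              ≡⟨ cong length (hIter-unfold k) ⟩
  length (hIter k ++ hIter k ++ b ∷ [])               ≡⟨ length-++ (hIter k) ⟩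
  length (hIter k) + length (hIter k ++ b ∷ [])       ≡⟨ cong (length (hIter k) +_) (length-++ (hIter k)) ⟩
  length (hIter k) + (length (hIter k) + 1)           ≡⟨ cong (λ p → p + (p + 1)) (length-hIter k) ⟩
  ℓ k + (ℓ k + 1)                                     ≡⟨ cong (ℓ k +_) (+-comm (ℓ k) 1) ⟩
  ℓ k + suc (ℓ k)                                     ≡⟨ +-suc (ℓ k) (ℓ k) ⟩
  suc (ℓ k + ℓ k)                                     ∎

nth-++ˡ : ∀ (xs ys : List Letter) i → i < length xs → nth (xs ++ ys) i ≡ nth xs i
nth-++ˡ (x ∷ xs) ys zero    _         = refl
nth-++ˡ (x ∷ xs) ys (suc i) (s≤s i<n) = nth-++ˡ xs ys i i<n

nth-++ʳ : ∀ (xs ys : List Letter) i → nth (xs ++ ys) (length xs + i) ≡ nth ys i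
nth-++ʳ []       ys i = refl
nth-++ʳ (x ∷ xs) ys i = nth-++ʳ xs ys i

hIter-extends : ∀ m i → i < ℓ m → nth (hIter (suc m)) i ≡ nth (hIter m) i
hIter-extends m i i<ℓm = begin
  nth (hIter (suc m)) i                 ≡⟨ cong (λ w → nth w i) (hIter-unfold m) ⟩
  nth (hIter m ++ hIter m ++ b ∷ []) i  ≡⟨ nth-++ˡ (hIter m) _ i (subst (i <_) (sym (length-hIter m)) i<ℓm) ⟩
  nth (hIter m) i                       ∎

hIter-prefix : ∀ {k m} i → k ≤′ m → i < ℓ k → nth (hIter m) i ≡ nth (hIter k) i
hIter-prefix i ≤′-refl           _    = refl
hIter-prefix i (≤′-step k≤′m) i<ℓk =
  trans (hIter-extends _ i (≤-trans i<ℓk (ℓ-mono (≤′⇒≤ k≤′m)))) (hIter-prefix i k≤′m i<ℓk)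

z-hIter : ∀ k i → i < ℓ k → z i ≡ nth (hIter k) i
z-hIter k i i<ℓk with ≤-total k (suc i)
... | inj₁ k≤1+i = hIter-prefix i (≤⇒≤′ k≤1+i) i<ℓk
... | inj₂ 1+i≤k = sym (hIter-prefix i (≤⇒≤′ 1+i≤k) (≤-trans (n≤1+n (suc i)) (k<ℓk (suc i))))

z-after-first-copy : ∀ k i → i ≤ ℓ k → z (ℓ k + i) ≡ nth (hIter k ++ b ∷ []) i
z-after-first-copy k i i≤ℓk = begin
  z (ℓ k + i)                                                ≡⟨ z-hIter (suc k) (ℓ k + i) (s≤s (+-monoʳ-≤ (ℓ k) i≤ℓk)) ⟩
  nth (hIter (suc k)) (ℓ k + i)                              ≡⟨ cong (λ w → nth w (ℓ k + i)) (hIter-unfold k) ⟩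
  nth (hIter k ++ hIter k ++ b ∷ []) (ℓ k + i)               ≡⟨ cong (λ p → nth (hIter k ++ hIter k ++ b ∷ []) (p + i)) (sym (length-hIter k)) ⟩
  nth (hIter k ++ hIter k ++ b ∷ []) (length (hIter k) + i)  ≡⟨ nth-++ʳ (hIter k) _ i ⟩
  nth (hIter k ++ b ∷ []) i                                  ∎

z-repeat : ∀ k i → i < ℓ k → z (ℓ k + i) ≡ z i
z-repeat k i i<ℓk = begin
  z (ℓ k + i)                ≡⟨ z-after-first-copy k i (<⇒≤ i<ℓk) ⟩
  nth (hIter k ++ b ∷ []) i  ≡⟨ nth-++ˡ (hIter k) _ i (subst (i <_) (sym (length-hIter k)) i<ℓk) ⟩
  nth (hIter k) i            ≡⟨ sym (z-hIter k i i<ℓk) ⟩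
  z i                        ∎

z-middle-b : ∀ k → z (ℓ k + ℓ k) ≡ b
z-middle-b k = begin
  z (ℓ k + ℓ k)                                      ≡⟨ z-after-first-copy k (ℓ k) ≤-refl ⟩
  nth (hIter k ++ b ∷ []) (ℓ k)                      ≡⟨ cong (nth (hIter k ++ b ∷ [])) (sym (trans (+-identityʳ _) (length-hIter k))) ⟩
  nth (hIter k ++ b ∷ []) (length (hIter k) + 0)     ≡⟨ nth-++ʳ (hIter k) _ 0 ⟩
  b                                                  ∎

trailing-b : ∀ k s t → s + suc t ≡ ℓ k → t < k → z s ≡ b
trailing-b (suc k) s zero    s+1≡ℓ _ = trans (cong z (suc-injective (trans (sym (+-comm s 1)) s+1≡ℓ))) (z-middle-b k)
trailing-b (suc k) s (suc t) s+t+2≡ℓ (s≤s t<k)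
  with split-sum s (suc t) (ℓ k) (ℓ k) (suc-injective (trans (sym (+-suc s (suc t))) s+t+2≡ℓ))
                 (≤-trans t<k (<⇒≤ (k<ℓk k)))
... | s' , refl , s'+t+1≡ℓ = trans (z-repeat k s' (m+1+n≡o⇒m<o s'+t+1≡ℓ)) (trailing-b k s' t s'+t+1≡ℓ t<k)

a-before-trailing : ∀ k s → s + suc k ≡ ℓ k → z s ≡ a
a-before-trailing zero    zero    _ = refl
a-before-trailing zero    (suc s) s+2≡1 = ⊥-elim (m+1+n≢0 s (suc-injective s+2≡1))
a-before-trailing (suc k) s s+k+2≡ℓ
  with split-sum s (suc k) (ℓ k) (ℓ k) (suc-injective (trans (sym (+-suc s (suc k))) s+k+2≡ℓ)) (k<ℓk k)
... | s' , refl , s'+k+1≡ℓ = trans (z-repeat k s' (m+1+n≡o⇒m<o s'+k+1≡ℓ)) (a-before-trailing k s' s'+k+1≡ℓ)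

a-in-window : ∀ k s → s + suc k ≤ ℓ k + ℓ k → ∃ λ r → r ≤ k × z (s + r) ≡ a
a-in-window zero    zero          _ = 0 , z≤n , refl
a-in-window zero    (suc zero)    _ = 0 , z≤n , refl
a-in-window zero    (suc (suc s)) (s≤s (s≤s s+1≤0)) = ⊥-elim (m+1+n≢0 s (n≤0⇒n≡0 s+1≤0))
a-in-window (suc k) s s+k+2≤2c = cases (s + suc (suc k) ≤? c) (c ≤? s)
  where
  c = ℓ (suc k)

  a-in-first-copy : ∀ s → s + suc (suc k) ≤ c → ∃ λ r → r ≤ suc k × z (s + r) ≡ a
  a-in-first-copy s in-first with a-in-window k s (≤-pred (subst (_≤ c) (+-suc s (suc k)) in-first))
  ... | r , r≤k , zr≡a = r , m≤n⇒m≤1+n r≤k , zr≡a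

  a-in-second-copy : ∀ s' → s' + suc (suc k) ≤ c → ∃ λ r → r ≤ suc k × z (c + s' + r) ≡ a
  a-in-second-copy s' in-copy with a-in-first-copy s' in-copy
  ... | r , r≤k+1 , zr≡a = r , r≤k+1 , (begin
    z (c + s' + r)    ≡⟨ cong z (+-assoc c s' r) ⟩
    z (c + (s' + r))  ≡⟨ z-repeat (suc k) (s' + r) (<-≤-trans (+-monoʳ-< s' (s≤s r≤k+1)) in-copy) ⟩
    z (s' + r)        ≡⟨ zr≡a ⟩
    a                 ∎)

  cases : Dec (s + suc (suc k) ≤ c) → Dec (c ≤ s) → ∃ λ r → r ≤ suc k × z (s + r) ≡ a
  cases (yes in-first) _ = a-in-first-copy s in-first
  cases (no _) (yes c≤s) with m≤n⇒∃[o]m+o≡n c≤s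
  ... | s' , refl = a-in-second-copy s'
          (+-cancelˡ-≤ c _ _ (subst (_≤ c + c) (+-assoc c s' (suc (suc k))) s+k+2≤2c))
  cases (no not-in-first) (no c≰s) with m≤n⇒∃[o]m+o≡n (<⇒≤ (≰⇒> c≰s))
  ... | r , s+r≡c = r , r≤k+1 , (begin
    z (s + r)   ≡⟨ cong z (trans s+r≡c (sym (+-identityʳ c))) ⟩
    z (c + 0)   ≡⟨ z-repeat (suc k) 0 (s≤s z≤n) ⟩
    a           ∎)
    where
    r≤k+1 : r ≤ suc k
    r≤k+1 = ≤-pred (+-cancelˡ-< s _ _ (subst (_< s + suc (suc k)) (sym s+r≡c) (≰⇒> not-in-first)))

window : (ℕ → Letter) → ℕ → ℕ → List Letter
window f i zero    = []
window f i (suc n) = f i ∷ window f (suc i) n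

block≡window : ∀ i n → block i n ≡ window z i n
block≡window i zero    = refl
block≡window i (suc n) = cong (z i ∷_) (block≡window (suc i) n)

length-window : ∀ f i n → length (window f i n) ≡ n
length-window f i zero    = refl
length-window f i (suc n) = cong suc (length-window f (suc i) n)

nth-window : ∀ f i n m → m < n → nth (window f i n) m ≡ f (i + m)
nth-window f i (suc n) zero    _         = cong f (sym (+-identityʳ i))
nth-window f i (suc n) (suc m) (s≤s m<n) = trans (nth-window f (suc i) n m m<n) (cong f (sym (+-suc i m)))

window-cong : ∀ f g i q n → (∀ m → m < n → f (i + m) ≡ g (q + m)) → window f i n ≡ window g q n
window-cong f g i q zero    _     = refl
window-cong f g i q (suc n) f≡g = cong₂ _∷_
  (trans (cong f (sym (+-identityʳ i))) (trans (f≡g 0 (s≤s z≤n)) (cong g (+-identityʳ q))))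
  (window-cong f g (suc i) (suc q) n λ m m<n →
    trans (cong f (sym (+-suc i m))) (trans (f≡g (suc m) (s≤s m<n)) (cong g (+-suc q m))))

HasBRun : ℕ → List Letter → Set
HasBRun m w = ∃ λ s → s + m ≤ length w × (∀ r → r < m → nth w (s + r) ≡ b)

LeadingBs : ℕ → List Letter → Set
LeadingBs t w = t ≤ length w × (∀ r → r < t → nth w r ≡ b)

leading-run≤longest : ∀ c w t → LeadingBs t w → c + t ≤ longestRunFrom c w
leading-run≤longest c w zero _ = subst (_≤ longestRunFrom c w) (sym (+-identityʳ c)) (current≤longest c w)
  where
  current≤longest : ∀ c w → c ≤ longestRunFrom c w
  current≤longest c []      = ≤-refl
  current≤longest c (b ∷ w) = ≤-trans (n≤1+n c) (current≤longest (suc c) w)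
  current≤longest c (a ∷ w) = m≤m⊔n c _
leading-run≤longest c (b ∷ w) (suc t) (s≤s t≤|w| , bs) =
  subst (_≤ longestRunFrom (suc c) w) (sym (+-suc c t))
    (leading-run≤longest (suc c) w t (t≤|w| , λ r r<t → bs (suc r) (s≤s r<t)))
leading-run≤longest c (a ∷ w) (suc t) (_ , bs) with bs 0 (s≤s z≤n)
... | ()

run≤longest : ∀ c w m → HasBRun m w → m ≤ longestRunFrom c w
run≤longest c w       zero    _ = z≤n
run≤longest c []      (suc m) (s , s+m+1≤0 , _) = ⊥-elim (m+1+n≢0 s (n≤0⇒n≡0 s+m+1≤0))
run≤longest c w@(_ ∷ _) (suc m) (zero , m+1≤|w| , bs) =
  ≤-trans (m≤n+m (suc m) c) (leading-run≤longest c w (suc m) (m+1≤|w| , bs))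
run≤longest c (b ∷ w) (suc m) (suc s , s≤s s+m+1≤|w| , bs) = run≤longest (suc c) w (suc m) (s , s+m+1≤|w| , bs)
run≤longest c (a ∷ w) (suc m) (suc s , s≤s s+m+1≤|w| , bs) =
  ≤-trans (run≤longest 0 w (suc m) (s , s+m+1≤|w| , bs)) (m≤n⊔m c _)

longest-realised : ∀ c m w → m ≤ longestRunFrom c w → HasBRun m w ⊎ (∃ λ t → m ≤ c + t × LeadingBs t w)
longest-realised c m [] m≤c = inj₂ (0 , subst (m ≤_) (sym (+-identityʳ c)) m≤c , z≤n , λ _ ())
longest-realised c m (b ∷ w) m≤longest with longest-realised (suc c) m w m≤longest
... | inj₁ (s , s+m≤|w| , bs)       = inj₁ (suc s , s≤s s+m≤|w| , bs)
... | inj₂ (t , m≤c+1+t , t≤|w| , bs) = inj₂ (suc t , subst (m ≤_) (sym (+-suc c t)) m≤c+1+t , s≤s t≤|w| , leading)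
  where
  leading : ∀ r → r < suc t → nth (b ∷ w) r ≡ b
  leading zero    _         = refl
  leading (suc r) (s≤s r<t) = bs r r<t
longest-realised c m (a ∷ w) m≤longest with ≤-total c (longestBRun w)
... | inj₂ rest≤c = inj₂ (0 , subst (m ≤_) (trans (m≥n⇒m⊔n≡m rest≤c) (sym (+-identityʳ c))) m≤longest , z≤n , λ _ ())
... | inj₁ c≤rest with longest-realised 0 m w (subst (m ≤_) (m≤n⇒m⊔n≡n c≤rest) m≤longest)
...   | inj₁ (s , s+m≤|w| , bs)     = inj₁ (suc s , s≤s s+m≤|w| , bs)
...   | inj₂ (t , m≤t , t≤|w| , bs) = inj₁ (1 , s≤s (≤-trans m≤t t≤|w|) , λ r r<m → bs r (≤-trans r<m m≤t))

longest-has-run : ∀ m w → m ≤ longestBRun w → HasBRun m w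
longest-has-run m w m≤longest with longest-realised 0 m w m≤longest
... | inj₁ run                   = run
... | inj₂ (t , m≤t , t≤|w| , bs) = 0 , ≤-trans m≤t t≤|w| , λ r r<m → bs r (≤-trans r<m m≤t)

longestBRun≡ : ∀ j w → HasBRun j w → ¬ HasBRun (suc j) w → longestBRun w ≡ j
longestBRun≡ j w run no-longer-run = ≤-antisym
  (≮⇒≥ λ j<longest → no-longer-run (longest-has-run (suc j) w j<longest))
  (run≤longest 0 w j run)

BRunAt : (ℕ → Letter) → ℕ → ℕ → Set
BRunAt f p m = ∀ r → r < m → f (p + r) ≡ b

RunWithin : (ℕ → Letter) → ℕ → ℕ → ℕ → Set
RunWithin f i n m = ∃ λ s → s + m ≤ n × BRunAt f (i + s) m

run-in-window : ∀ f i n m → RunWithin f i n m → HasBRun m (window f i n)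
run-in-window f i n m (s , s+m≤n , bs) = s , subst (s + m ≤_) (sym (length-window f i n)) s+m≤n , λ r r<m →
  trans (nth-window f i n (s + r) (<-≤-trans (+-monoʳ-< s r<m) s+m≤n)) (trans (cong f (sym (+-assoc i s r))) (bs r r<m))

run-of-window : ∀ f i n m → HasBRun m (window f i n) → RunWithin f i n m
run-of-window f i n m (s , s+m≤|w| , bs) = s , s+m≤n , λ r r<m →
  trans (cong f (+-assoc i s r)) (trans (sym (nth-window f i n (s + r) (<-≤-trans (+-monoʳ-< s r<m) s+m≤n))) (bs r r<m))
  where
  s+m≤n : s + m ≤ n
  s+m≤n = subst (s + m ≤_) (length-window f i n) s+m≤|w|

longestBRun-window : ∀ f i n j → RunWithin f i n j → ¬ RunWithin f i n (suc j) → longestBRun (window f i n) ≡ j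
longestBRun-window f i n j run no-longer-run =
  longestBRun≡ j (window f i n) (run-in-window f i n j run) (λ longer → no-longer-run (run-of-window f i n (suc j) longer))

longestBRun-window-bound : ∀ f i n j → longestBRun (window f i n) ≡ j → ¬ RunWithin f i n (suc j)
longestBRun-window-bound f i n j longest≡j longer =
  n≮n j (subst (suc j ≤_) longest≡j (run≤longest 0 (window f i n) (suc j) (run-in-window f i n (suc j) longer)))

trailing-run : ∀ k p m → p + m ≡ ℓ k → m ≤ k → BRunAt z p m
trailing-run k p m p+m≡ℓ m≤k r r<m with m≤n⇒∃[o]m+o≡n r<m
... | t , 1+r+t≡m = trailing-b k (p + r) t p+r+1+t≡ℓ (<-≤-trans (m+n≡o⇒n≤o (trans (+-suc r t) 1+r+t≡m)) m≤k)
  where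
  p+r+1+t≡ℓ : p + r + suc t ≡ ℓ k
  p+r+1+t≡ℓ = trans (+-assoc p r (suc t)) (trans (cong (p +_) (trans (+-suc r t) 1+r+t≡m)) p+m≡ℓ)

-- X j = b^j z. Its prefix of length Xlen j = j + 2ℓ j is b^j h^j(a) h^j(a); the factors counted
-- by the theorem are exactly its windows.
X : ℕ → ℕ → Letter
X zero    q       = z q
X (suc j) zero    = b
X (suc j) (suc q) = X j q

Xlen : ℕ → ℕ
Xlen j = j + (ℓ j + ℓ j)

ℓ+j≤Xlen : ∀ j → ℓ j + j ≤ Xlen j
ℓ+j≤Xlen j = subst (_≤ Xlen j) (+-comm j (ℓ j)) (+-monoʳ-≤ j (m≤m+n (ℓ j) (ℓ j)))

X-prefix : ∀ j q → q < j → X j q ≡ b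
X-prefix (suc j) zero    _         = refl
X-prefix (suc j) (suc q) (s≤s q<j) = X-prefix j q q<j

X-body : ∀ j r → X j (j + r) ≡ z r
X-body zero    r = refl
X-body (suc j) r = X-body j r

-- The prefix of length Xlen j of X j occurs in z: h^(j+1)(a) ends with b^j and is followed
-- by a second copy of h^(j+1)(a), which begins with h^j(a) h^j(a).
X-occurs : ∀ j → ∃ λ o → ∀ r → r < Xlen j → z (o + r) ≡ X j r
X-occurs j with m≤n⇒∃[o]m+o≡n (≤-trans (n≤1+n j) (<⇒≤ (k<ℓk (suc j))))
... | o , j+o≡ℓ = o , letters
  where
  o+j≡ℓ : o + j ≡ ℓ (suc j)
  o+j≡ℓ = trans (+-comm o j) j+o≡ℓ

  letters : ∀ r → r < Xlen j → z (o + r) ≡ X j r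
  letters r r<Xlen with cut j r
  ... | before t r+1+t≡j = trans (trailing-b (suc j) (o + r) t o+r+1+t≡ℓ (≤-trans (m+n≡o⇒n≤o r+1+t≡j) (n≤1+n j)))
                                    (sym (X-prefix j r (m+1+n≡o⇒m<o r+1+t≡j)))
    where
    o+r+1+t≡ℓ : o + r + suc t ≡ ℓ (suc j)
    o+r+1+t≡ℓ = trans (+-assoc o r (suc t)) (trans (cong (o +_) r+1+t≡j) o+j≡ℓ)
  ... | beyond r' refl = begin
    z (o + (j + r'))    ≡⟨ cong z (trans (sym (+-assoc o j r')) (cong (_+ r') o+j≡ℓ)) ⟩
    z (ℓ (suc j) + r')  ≡⟨ z-repeat (suc j) r' (≤-trans (+-cancelˡ-< j _ _ r<Xlen) (n≤1+n _)) ⟩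
    z r'                ≡⟨ sym (X-body j r') ⟩
    X j (j + r')        ∎

X-a-in-window : ∀ j s → s + suc j ≤ Xlen j → ∃ λ r → r ≤ j × X j (s + r) ≡ a
X-a-in-window j s s+j+1≤Xlen with cut j s
... | before t s+1+t≡j = suc t , m+n≡o⇒n≤o s+1+t≡j , (begin
  X j (s + suc t)   ≡⟨ cong (X j) (trans s+1+t≡j (sym (+-identityʳ j))) ⟩
  X j (j + 0)       ≡⟨ X-body j 0 ⟩
  a                 ∎)
... | beyond s' refl with a-in-window j s' (+-cancelˡ-≤ j _ _ (subst (_≤ Xlen j) (+-assoc j s' (suc j)) s+j+1≤Xlen))
...   | r , r≤j , zs'r≡a = r , r≤j , trans (cong (X j) (+-assoc j s' r)) (trans (X-body j (s' + r)) zs'r≡a)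

-- The prefix of length Xlen j of X j has period ℓ j: the b^j ending h^j(a) mirrors the prefix b^j.
X-repeat : ∀ j q → ℓ j + q < Xlen j → X j (ℓ j + q) ≡ X j q
X-repeat j q ℓ+q<Xlen with cut j q
... | before t q+1+t≡j with m≤n⇒∃[o]m+o≡n (≤-trans (m+n≡o⇒n≤o q+1+t≡j) (<⇒≤ (k<ℓk j)))
...   | u , 1+t+u≡ℓ = begin
  X j (ℓ j + q)   ≡⟨ cong (X j) ℓ+q≡j+u ⟩
  X j (j + u)     ≡⟨ X-body j u ⟩
  z u             ≡⟨ trailing-b j u t (trans (+-comm u (suc t)) 1+t+u≡ℓ) (m+n≡o⇒n≤o q+1+t≡j) ⟩
  b               ≡⟨ sym (X-prefix j q (m+1+n≡o⇒m<o q+1+t≡j)) ⟩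
  X j q           ∎
  where
  ℓ+q≡j+u : ℓ j + q ≡ j + u
  ℓ+q≡j+u = +-cancelʳ-≡ (suc t) _ _ (begin
    ℓ j + q + suc t      ≡⟨ +-assoc (ℓ j) q (suc t) ⟩
    ℓ j + (q + suc t)    ≡⟨ cong (ℓ j +_) q+1+t≡j ⟩
    ℓ j + j              ≡⟨ +-comm (ℓ j) j ⟩
    j + ℓ j              ≡⟨ cong (j +_) (sym (trans (+-comm u (suc t)) 1+t+u≡ℓ)) ⟩
    j + (u + suc t)      ≡⟨ sym (+-assoc j u (suc t)) ⟩
    j + u + suc t        ∎)
X-repeat j q ℓ+q<Xlen | beyond r refl = begin
  X j (ℓ j + (j + r))   ≡⟨ cong (X j) (x∙yz≈y∙xz (ℓ j) j r) ⟩
  X j (j + (ℓ j + r))   ≡⟨ X-body j (ℓ j + r) ⟩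
  z (ℓ j + r)           ≡⟨ z-repeat j r r<ℓ ⟩
  z r                   ≡⟨ sym (X-body j r) ⟩
  X j (j + r)           ∎
  where
  r<ℓ : r < ℓ j
  r<ℓ = +-cancelˡ-< (ℓ j) _ _ (+-cancelˡ-< j _ _ (subst (_< Xlen j) (x∙yz≈y∙xz (ℓ j) j r) ℓ+q<Xlen))

X-run-at-repeat : ∀ j → BRunAt (X j) (ℓ j) j
X-run-at-repeat j r r<j = trans (X-repeat j r (<-≤-trans (+-monoʳ-< (ℓ j) r<j) (ℓ+j≤Xlen j))) (X-prefix j r r<j)

X-a-before-repeat : ∀ j s → suc s ≡ ℓ j → X j s ≡ a
X-a-before-repeat j s 1+s≡ℓ with cut j s
... | before t s+1+t≡j = ⊥-elim (<⇒≱ (k<ℓk j) (subst (_≤ j) 1+s≡ℓ (m+1+n≡o⇒m<o s+1+t≡j)))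
... | beyond r refl = trans (X-body j r) (a-before-trailing j r (trans (+-suc r j) (trans (cong suc (+-comm r j)) 1+s≡ℓ)))

-- Before position ℓ j - 1, an a of X j is never followed by j b's: such a run would lie in z
-- before position 2ℓ(j-1).
X-a-then-run : ∀ j p → suc p < ℓ j → X j p ≡ a → ¬ BRunAt (X j) (suc p) j
X-a-then-run zero p (s≤s ())
X-a-then-run j@(suc j₀) p 1+p<ℓ Xp≡a run with cut j p
... | before t p+1+t≡j = a≢b (trans (sym Xp≡a) (X-prefix j p (m+1+n≡o⇒m<o p+1+t≡j)))
... | beyond y refl with a-in-window j₀ (suc y) y+j+1≤2ℓ
  where
  y+j+1≤2ℓ : suc y + suc j₀ ≤ ℓ j₀ + ℓ j₀
  y+j+1≤2ℓ = ≤-pred (subst (_< ℓ j) (cong suc (+-comm j y)) 1+p<ℓ)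
...   | r , r≤j₀ , z≡a = a≢b (begin
  a                         ≡⟨ sym z≡a ⟩
  z (suc y + r)             ≡⟨ sym (X-body j (suc y + r)) ⟩
  X j (j + (suc y + r))     ≡⟨ cong (X j) (trans (sym (+-assoc j (suc y) r)) (cong (_+ r) (+-suc j y))) ⟩
  X j (suc (j + y) + r)     ≡⟨ run r (s≤s r≤j₀) ⟩
  b                         ∎)

-- Windows of X j of length n ≥ ℓ j + j - 1 starting at different positions below ℓ j differ:
-- the later one shows the a at position ℓ j - 1 followed by b^j, which the earlier one would
-- have to show before position ℓ j - 1.
X-windows-distinct : ∀ j n i i' → ℓ j + j ≤ n + 1 → i < i' → i' < ℓ j → ¬ window (X j) i n ≡ window (X j) i' n
X-windows-distinct j n i i' ℓ+j≤n+1 i<i' i'<ℓ same with m≤n⇒∃[o]m+o≡n i'<ℓ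
... | o , 1+i'+o≡ℓ = X-a-then-run j (i + o) 1+i+o<ℓ
  (trans (agree o (<-≤-trans (n<1+n o) (m+n≤o⇒m≤o (suc o) 1+o+j≤n))) (X-a-before-repeat j (i' + o) 1+i'+o≡ℓ))
  λ r r<j → begin
    X j (suc (i + o) + r)      ≡⟨ cong (X j) (trans (cong (_+ r) (sym (+-suc i o))) (+-assoc i (suc o) r)) ⟩
    X j (i + (suc o + r))      ≡⟨ agree (suc o + r) (<-≤-trans (+-monoʳ-< (suc o) r<j) 1+o+j≤n) ⟩
    X j (i' + (suc o + r))     ≡⟨ cong (X j) (trans (sym (+-assoc i' (suc o) r)) (cong (_+ r) i'+1+o≡ℓ)) ⟩
    X j (ℓ j + r)              ≡⟨ X-run-at-repeat j r r<j ⟩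
    b                          ∎
  where
  agree : ∀ m → m < n → X j (i + m) ≡ X j (i' + m)
  agree m m<n = trans (sym (nth-window (X j) i n m m<n)) (trans (cong (λ w → nth w m) same) (nth-window (X j) i' n m m<n))

  i'+1+o≡ℓ : i' + suc o ≡ ℓ j
  i'+1+o≡ℓ = trans (+-suc i' o) 1+i'+o≡ℓ

  1+i+o<ℓ : suc (i + o) < ℓ j
  1+i+o<ℓ = subst (suc (i + o) <_) 1+i'+o≡ℓ (s≤s (+-monoˡ-< o i<i'))

  1+o+j≤n : suc o + j ≤ n
  1+o+j≤n = room-after (≤-trans (s≤s z≤n) i<i') i'+1+o≡ℓ ℓ+j≤n+1

-- A window of X j of length n ≥ ℓ j + j - 1 starting below ℓ j contains b^j: the prefix b^j
-- if it starts at 0, and the copy of b^j at position ℓ j otherwise.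
X-window-run : ∀ j n i → ℓ j + j ≤ n + 1 → j < n → i < ℓ j → RunWithin (X j) i n j
X-window-run j n zero      _         j<n _ = 0 , <⇒≤ j<n , X-prefix j
X-window-run j n i@(suc _) ℓ+j≤n+1 _  i<ℓ with m≤n⇒∃[o]m+o≡n (<⇒≤ i<ℓ)
... | s , i+s≡ℓ = s , room-after (s≤s z≤n) i+s≡ℓ ℓ+j≤n+1 ,
  λ r r<j → trans (cong (λ p → X j (p + r)) i+s≡ℓ) (X-run-at-repeat j r r<j)

X-window-no-long-run : ∀ j n i → i + n ≤ Xlen j → ¬ RunWithin (X j) i n (suc j)
X-window-no-long-run j n i i+n≤Xlen (s , s+j+1≤n , run)
  with X-a-in-window j (i + s) (≤-trans (≤-reflexive (+-assoc i s (suc j))) (≤-trans (+-monoʳ-≤ i s+j+1≤n) i+n≤Xlen))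
... | r , r≤j , Xa = a≢b (trans (sym Xa) (run r (s≤s r≤j)))

X-window-factor : ∀ j n i → i + n ≤ Xlen j → IsFactor (window (X j) i n)
X-window-factor j n i i+n≤Xlen with X-occurs j
... | o , occurs = o + i , (begin
  block (o + i) (length (window (X j) i n))   ≡⟨ cong (block (o + i)) (length-window (X j) i n) ⟩
  block (o + i) n                             ≡⟨ block≡window (o + i) n ⟩
  window z (o + i) n                          ≡⟨ window-cong z (X j) (o + i) i n agree ⟩
  window (X j) i n                            ∎)
  where
  agree : ∀ m → m < n → z (o + i + m) ≡ X j (i + m)
  agree m m<n = trans (cong z (+-assoc o i m)) (occurs (i + m) (<-≤-trans (+-monoʳ-< i m<n) i+n≤Xlen))

X-window-counted : ∀ j n i → ℓ j + j ≤ n + 1 → j < n → i < ℓ j → i + n ≤ Xlen j →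
                   IsFactor (window (X j) i n) × length (window (X j) i n) ≡ n × longestBRun (window (X j) i n) ≡ j
X-window-counted j n i ℓ+j≤n+1 j<n i<ℓ i+n≤Xlen =
  X-window-factor j n i i+n≤Xlen ,
  length-window (X j) i n ,
  longestBRun-window (X j) i n j (X-window-run j n i ℓ+j≤n+1 j<n i<ℓ) (X-window-no-long-run j n i i+n≤Xlen)

module FactorsOfZ (j n : ℕ) (j<n : j < n) where

  NoLongRun : ℕ → Set
  NoLongRun i = ¬ RunWithin z i n (suc j)

  InX : ℕ → Set
  InX i = ∃ λ q → q + n ≤ Xlen j × (∀ m → m < n → z (i + m) ≡ X j (q + m))

  inX-prefix : ∀ i → i + n ≤ ℓ j + ℓ j → InX i
  inX-prefix i i+n≤2ℓ = j + i , subst (_≤ Xlen j) (sym (+-assoc j i n)) (+-monoʳ-≤ j i+n≤2ℓ) ,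
    λ m _ → sym (trans (cong (X j) (+-assoc j i m)) (X-body j (i + m)))

  inX-in-copy : ∀ k i → i + n ≤ ℓ k → InX i → InX (ℓ k + i)
  inX-in-copy k i i+n≤ℓ (q , q+n≤Xlen , agree) = q , q+n≤Xlen , λ m m<n →
    trans (cong z (+-assoc (ℓ k) i m)) (trans (z-repeat k (i + m) (<-≤-trans (+-monoʳ-< i m<n) i+n≤ℓ)) (agree m m<n))

  noLongRun-from-copy : ∀ k i → i + n ≤ ℓ k → NoLongRun (ℓ k + i) → NoLongRun i
  noLongRun-from-copy k i i+n≤ℓ no-run (s , s+j+1≤n , bs) = no-run (s , s+j+1≤n , λ r r<j+1 → begin
    z (ℓ k + i + s + r)      ≡⟨ cong z (trans (cong (_+ r) (+-assoc (ℓ k) i s)) (+-assoc (ℓ k) (i + s) r)) ⟩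
    z (ℓ k + (i + s + r))    ≡⟨ z-repeat k (i + s + r) (<-≤-trans (run-inside s r s+j+1≤n r<j+1) i+n≤ℓ) ⟩
    z (i + s + r)            ≡⟨ bs r r<j+1 ⟩
    b                        ∎)
    where
    run-inside : ∀ s r → s + suc j ≤ n → r < suc j → i + s + r < i + n
    run-inside s r s+j+1≤n r<j+1 =
      subst (_< i + n) (sym (+-assoc i s r)) (+-monoʳ-< i (<-≤-trans (+-monoʳ-< s r<j+1) s+j+1≤n))

  -- Three sources of b^(j+1) in a window, for j < k: the window ends where h^k(a) ends; the window
  -- covers the last s > j letters of h^k(a); or, starting s letters before the second copy of
  -- h^k(a), it runs past the first 2ℓ j letters of that copy and so covers the b^(j+1) ending the
  -- h^(j+1)(a) at its start.
  run-ending-at : ∀ k i → j < k → i + n ≡ ℓ k → RunWithin z i n (suc j)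
  run-ending-at k i j<k i+n≡ℓ with m≤n⇒∃[o]m+o≡n j<n
  ... | s , 1+j+s≡n = s , ≤-reflexive s+j+1≡n ,
    trailing-run k (i + s) (suc j) (trans (+-assoc i s (suc j)) (trans (cong (i +_) s+j+1≡n) i+n≡ℓ)) j<k
    where
    s+j+1≡n : s + suc j ≡ n
    s+j+1≡n = trans (+-comm s (suc j)) 1+j+s≡n

  run-before-copy : ∀ k i s → j < k → i + s ≡ ℓ k → j < s → s ≤ n → RunWithin z i n (suc j)
  run-before-copy k i s j<k i+s≡ℓ j<s s≤n with m≤n⇒∃[o]m+o≡n j<s
  ... | d , 1+j+d≡s = d , ≤-trans (≤-reflexive d+j+1≡s) s≤n ,
    trailing-run k (i + d) (suc j) (trans (+-assoc i d (suc j)) (trans (cong (i +_) d+j+1≡s) i+s≡ℓ)) j<k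
    where
    d+j+1≡s : d + suc j ≡ s
    d+j+1≡s = trans (+-comm d (suc j)) 1+j+d≡s

  run-in-second-copy : ∀ k i s → j < k → i + s ≡ ℓ k → s + (ℓ j + ℓ j) < n → RunWithin z i n (suc j)
  run-in-second-copy k i s j<k i+s≡ℓ overflow with m≤n⇒∃[o]m+o≡n (<⇒≤ (k<ℓk (suc j)))
  ... | y , 1+j+y≡ℓ = s + y , fits , λ r r<j+1 → begin
    z (i + (s + y) + r)    ≡⟨ cong z (shift r) ⟩
    z (ℓ k + (y + r))      ≡⟨ z-repeat k (y + r) (<-≤-trans (+-monoʳ-< y r<j+1) (≤-trans (≤-reflexive y+j+1≡ℓ) (ℓ-mono j<k))) ⟩
    z (y + r)              ≡⟨ trailing-run (suc j) y (suc j) y+j+1≡ℓ ≤-refl r r<j+1 ⟩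
    b                      ∎
    where
    y+j+1≡ℓ : y + suc j ≡ ℓ (suc j)
    y+j+1≡ℓ = trans (+-comm y (suc j)) 1+j+y≡ℓ
    fits : s + y + suc j ≤ n
    fits = subst (_≤ n) (sym (trans (+-assoc s y (suc j)) (trans (cong (s +_) y+j+1≡ℓ) (+-suc s _)))) overflow
    shift : ∀ r → i + (s + y) + r ≡ ℓ k + (y + r)
    shift r = trans (+-assoc i (s + y) r) (trans (cong (i +_) (+-assoc s y r))
              (trans (sym (+-assoc i s (y + r))) (cong (_+ (y + r)) i+s≡ℓ)))

  -- A window that starts s ≤ j letters before the second copy of h^k(a) and ends within its first
  -- 2ℓ j letters reads b^s h^j(a) h^j(a)…, a window of X j at q = j - s.
  straddle-fits : ∀ k i s q → j < k → i + s ≡ ℓ k → q + s ≡ j → n ≤ s + (ℓ j + ℓ j) → InX i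
  straddle-fits k i s q j<k i+s≡ℓ q+s≡j n≤s+2ℓ = q , q+n≤Xlen , agree
    where
    q+n≤Xlen : q + n ≤ Xlen j
    q+n≤Xlen = subst (q + n ≤_) (trans (sym (+-assoc q s _)) (cong (_+ (ℓ j + ℓ j)) q+s≡j)) (+-monoʳ-≤ q n≤s+2ℓ)

    agree : ∀ m → m < n → z (i + m) ≡ X j (q + m)
    agree m m<n with cut s m
    ... | before t m+1+t≡s = begin
      z (i + m)       ≡⟨ trailing-b k (i + m) t i+m+1+t≡ℓ (≤-trans (m+n≡o⇒n≤o m+1+t≡s) (≤-trans s≤j (<⇒≤ j<k))) ⟩
      b               ≡⟨ sym (X-prefix j (q + m) (m+1+n≡o⇒m<o q+m+1+t≡j)) ⟩
      X j (q + m)     ∎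
      where
      s≤j : s ≤ j
      s≤j = m+n≡o⇒n≤o q+s≡j
      i+m+1+t≡ℓ : i + m + suc t ≡ ℓ k
      i+m+1+t≡ℓ = trans (+-assoc i m (suc t)) (trans (cong (i +_) m+1+t≡s) i+s≡ℓ)
      q+m+1+t≡j : q + m + suc t ≡ j
      q+m+1+t≡j = trans (+-assoc q m (suc t)) (trans (cong (q +_) m+1+t≡s) q+s≡j)
    ... | beyond m' refl = begin
      z (i + (s + m'))    ≡⟨ cong z (trans (sym (+-assoc i s m')) (cong (_+ m') i+s≡ℓ)) ⟩
      z (ℓ k + m')        ≡⟨ z-repeat k m' m'<ℓ ⟩
      z m'                ≡⟨ sym (X-body j m') ⟩
      X j (j + m')        ≡⟨ cong (X j) (trans (cong (_+ m') (sym q+s≡j)) (+-assoc q s m')) ⟩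
      X j (q + (s + m'))  ∎
      where
      m'<ℓ : m' < ℓ k
      m'<ℓ = ≤-trans (+-cancelˡ-< s _ _ (<-≤-trans m<n n≤s+2ℓ)) (≤-trans (n≤1+n _) (ℓ-mono j<k))

  straddle : ∀ k i s → j < k → i + s ≡ ℓ k → s < n → i + n ≤ ℓ k + ℓ k → NoLongRun i → InX i
  straddle k i s j<k i+s≡ℓ s<n i+n≤2ℓ no-run with j <? s
  ... | yes j<s = ⊥-elim (no-run (run-before-copy k i s j<k i+s≡ℓ j<s (<⇒≤ s<n)))
  ... | no j≮s with m≤n⇒∃[o]m+o≡n (≮⇒≥ j≮s) | n ≤? s + (ℓ j + ℓ j)
  ...   | q , s+q≡j | yes n≤s+2ℓ = straddle-fits k i s q j<k i+s≡ℓ (trans (+-comm q s) s+q≡j) n≤s+2ℓ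
  ...   | _         | no n≰s+2ℓ = ⊥-elim (no-run (run-in-second-copy k i s j<k i+s≡ℓ (≰⇒> n≰s+2ℓ)))

  extend : ∀ k → j ≤ k → (∀ i → i + n ≤ ℓ k → NoLongRun i → InX i) →
                         (∀ i → i + n ≤ ℓ (suc k) → NoLongRun i → InX i)
  extend k j≤k inX-below i i+n≤ℓ' no-run
    with i + n ≤? ℓ j + ℓ j | i + n ≤? ℓ k | m≤n⇒m<n∨m≡n i+n≤ℓ' | ℓ k ≤? i
  ... | yes i+n≤2ℓj | _ | _ | _ = inX-prefix i i+n≤2ℓj
  ... | no _ | yes i+n≤ℓ | _ | _ = inX-below i i+n≤ℓ no-run
  ... | no _ | no _ | inj₂ i+n≡ℓ' | _ = ⊥-elim (no-run (run-ending-at (suc k) i (s≤s j≤k) i+n≡ℓ'))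
  ... | no _ | no _ | inj₁ (s≤s i+n≤2ℓ) | yes ℓ≤i with m≤n⇒∃[o]m+o≡n ℓ≤i
  ...   | i' , refl = inX-in-copy k i' i'+n≤ℓ (inX-below i' i'+n≤ℓ (noLongRun-from-copy k i' i'+n≤ℓ no-run))
    where
    i'+n≤ℓ : i' + n ≤ ℓ k
    i'+n≤ℓ = +-cancelˡ-≤ (ℓ k) _ _ (subst (_≤ ℓ k + ℓ k) (+-assoc (ℓ k) i' n) i+n≤2ℓ)
  extend k j≤k inX-below i i+n≤ℓ' no-run | no i+n≰2ℓj | no i+n≰ℓ | inj₁ (s≤s i+n≤2ℓ) | no ℓ≰i
    with m≤n⇒∃[o]m+o≡n (<⇒≤ (≰⇒> ℓ≰i))
  ... | s , i+s≡ℓ = straddle k i s j<k i+s≡ℓ (+-cancelˡ-< i _ _ (subst (_< i + n) (sym i+s≡ℓ) (≰⇒> i+n≰ℓ))) i+n≤2ℓ no-run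
    where
    j<k : j < k
    j<k = ≤∧≢⇒< j≤k λ { refl → i+n≰2ℓj i+n≤2ℓ }

  inX-below : ∀ K i → i + n ≤ ℓ (K + j) → NoLongRun i → InX i
  inX-below zero    i i+n≤ℓ _ = inX-prefix i (≤-trans i+n≤ℓ (m≤m+n (ℓ j) (ℓ j)))
  inX-below (suc K) = extend (K + j) (m≤n+m j K) (inX-below K)

  inX : ∀ i → NoLongRun i → InX i
  inX i = inX-below (i + n) i (≤-trans (<⇒≤ (k<ℓk (i + n))) (ℓ-mono (m≤m+n (i + n) j)))

factor-is-X-window : ∀ j n → j < n → ∀ w → IsFactor w → length w ≡ n → longestBRun w ≡ j →
                     ∃ λ q → q + n ≤ Xlen j × w ≡ window (X j) q n
factor-is-X-window j n j<n w (i , block≡w) |w|≡n longest≡j = as-X-window (inX i no-long-run)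
  where
  open FactorsOfZ j n j<n using (InX; inX)

  window≡w : window z i n ≡ w
  window≡w = trans (sym (block≡window i n)) (trans (cong (block i) (sym |w|≡n)) block≡w)

  no-long-run : ¬ RunWithin z i n (suc j)
  no-long-run = longestBRun-window-bound z i n j (subst (λ u → longestBRun u ≡ j) (sym window≡w) longest≡j)

  as-X-window : InX i → ∃ λ q → q + n ≤ Xlen j × w ≡ window (X j) q n
  as-X-window (q , q+n≤Xlen , agree) = q , q+n≤Xlen , trans (sym window≡w) (window-cong z (X j) i q n agree)

FRange : ℕ → ℕ → Set
FRange n j = ℓ j + j ≤ n + 1 × n ≤ Xlen j

2^[k+1]≡1+ℓ : ∀ k → 2 ^ (k + 1) ≡ suc (ℓ k)
2^[k+1]≡1+ℓ k = trans (cong (2 ^_) (+-comm k 1)) (2^suc≡1+ℓ k)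

IsF⇒FRange : ∀ n j → IsF n j → FRange n j
IsF⇒FRange n j (lower , upper) =
  ≤-pred (subst₂ _≤_ (cong (_+ j) (2^[k+1]≡1+ℓ j)) (+-suc n 1) lower) ,
  +-cancelʳ-≤ 2 n (Xlen j) (subst (n + 2 ≤_) 2^[j+2]+j≡Xlen+2 upper)
  where
  rearrange : ∀ p j → suc (suc (p + p)) + j ≡ j + (p + p) + 2
  rearrange = solve-∀
  2^[j+2]+j≡Xlen+2 : 2 ^ (j + 2) + j ≡ Xlen j + 2
  2^[j+2]+j≡Xlen+2 = trans (cong (λ m → 2 ^ m + j) (+-suc j 1))
                     (trans (cong (_+ j) (2^[k+1]≡1+ℓ (suc j))) (rearrange (ℓ j) j))

-- Consecutive ranges abut (Xlen u + 2 = ℓ(u+1) + (u+1)), so different ranges are disjoint.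
FRange-gap : ∀ n u j → u < j → FRange n u → FRange n j → ⊥
FRange-gap n u j u<j (_ , n≤Xlen) (ℓ+j≤n+1 , _)
  with +-cancelˡ-≤ n 2 1 (≤-trans (+-monoˡ-≤ 2 n≤Xlen)
         (≤-trans (≤-reflexive (Xlen+2≡ℓ'+u' (ℓ u) u)) (≤-trans (+-mono-≤ (ℓ-mono u<j) u<j) ℓ+j≤n+1)))
  where
  Xlen+2≡ℓ'+u' : ∀ p u → u + (p + p) + 2 ≡ suc (p + p) + suc u
  Xlen+2≡ℓ'+u' = solve-∀
... | s≤s ()

FRange-unique : ∀ n j u → FRange n j → FRange n u → j ≡ u
FRange-unique n j u range-j range-u with <-cmp j u
... | tri< j<u _ _ = ⊥-elim (FRange-gap n j u j<u range-j range-u)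
... | tri≈ _ j≡u _ = j≡u
... | tri> _ _ u<j = ⊥-elim (FRange-gap n u j u<j range-u range-j)

FRange⇒j<n : ∀ n j → 1 ≤ n → ℓ j + j ≤ n + 1 → j < n
FRange⇒j<n n zero    1≤n _ = 1≤n
FRange⇒j<n n (suc j) _   ℓ+j≤n+1 = ≤-pred (≤-trans (+-monoˡ-≤ (suc j) 2≤ℓ) (≤-trans ℓ+j≤n+1 (≤-reflexive (+-comm n 1))))
  where
  2≤ℓ : 2 ≤ ℓ (suc j)
  2≤ℓ = s≤s (≤-trans (≤-trans (s≤s z≤n) (k<ℓk j)) (m≤m+n (ℓ j) (ℓ j)))

-- The value v = g(n) in terms of ℓ j: either v = ℓ j and every window starting below ℓ j fits in
-- the prefix of length Xlen j, or v ≤ ℓ j and v = Xlen j - n + 1 counts all of its windows.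
data Count (n j v : ℕ) : Set where
  every-residue : v ≡ ℓ j → v + n ≤ suc (Xlen j) → Count n j v
  every-window  : v ≤ ℓ j → v + n ≡ suc (Xlen j) → Count n j v

-- The first case of g: 2^t+t-3 ≤ n ≤ 2^t+t-1 with t = u+1 and p = ℓ u = 2^t - 1.
plateau : ∀ p u n → 1 ≤ p → suc p + suc u ≤ n + 3 → n + 3 ≤ suc p + suc u + 2 →
          (p + u ≤ n + 1 × n ≤ u + (p + p)) × p + n ≤ suc (u + (p + p))
plateau p u n 1≤p lower upper =
  (+-cancelʳ-≤ 2 (p + u) (n + 1) (subst₂ _≤_ (e₁ p u) (e₂ n) lower) ,
   ≤-trans n≤p+u+1 (≤-trans (≤-reflexive (e₃ p u)) (+-monoʳ-≤ u (+-monoʳ-≤ p 1≤p)))) ,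
  ≤-trans (+-monoʳ-≤ p n≤p+u+1) (≤-reflexive (e₄ p u))
  where
  e₁ : ∀ p u → suc p + suc u ≡ p + u + 2
  e₁ = solve-∀
  e₂ : ∀ n → n + 3 ≡ n + 1 + 2
  e₂ = solve-∀
  e₃ : ∀ p u → p + u + 1 ≡ u + (p + 1)
  e₃ = solve-∀
  e₄ : ∀ p u → p + (p + u + 1) ≡ suc (u + (p + p))
  e₄ = solve-∀
  n≤p+u+1 : n ≤ p + u + 1
  n≤p+u+1 = +-cancelʳ-≤ 3 n (p + u + 1) (subst (n + 3 ≤_) (e₅ p u) upper)
    where
    e₅ : ∀ p u → suc p + suc u + 2 ≡ p + u + 1 + 3
    e₅ = solve-∀

slope : ∀ p u n v → suc p + suc u ≤ n + 1 → n + 3 ≤ suc (suc (p + p)) + suc u →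
        v ≡ (suc (suc (p + p)) + suc u) ∸ (n + 2) →
        (p + u ≤ n + 1 × n ≤ u + (p + p)) × v ≤ p × v + n ≡ suc (u + (p + p))
slope p u n v lower upper v≡ =
  (≤-trans (m≤m+n (p + u) 1) (≤-trans p+u+1≤n (m≤m+n n 1)) , n≤Xlen) ,
  +-cancelʳ-≤ (p + u + 1) v p (≤-trans (+-monoʳ-≤ v p+u+1≤n) (≤-reflexive (trans v+n≡ (e₃ p u)))) ,
  v+n≡
  where
  e₁ : ∀ p u → suc p + suc u ≡ p + u + 1 + 1
  e₁ = solve-∀
  e₂ : ∀ p u → suc (suc (p + p)) + suc u ≡ u + (p + p) + 3
  e₂ = solve-∀
  e₃ : ∀ p u → suc (u + (p + p)) ≡ p + (p + u + 1)
  e₃ = solve-∀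
  e₄ : ∀ p u → suc (suc (p + p)) + suc u ≡ 2 + suc (u + (p + p))
  e₄ = solve-∀
  p+u+1≤n : p + u + 1 ≤ n
  p+u+1≤n = +-cancelʳ-≤ 1 (p + u + 1) n (subst (_≤ n + 1) (e₁ p u) lower)
  n≤Xlen : n ≤ u + (p + p)
  n≤Xlen = +-cancelʳ-≤ 3 n (u + (p + p)) (subst (n + 3 ≤_) (e₂ p u) upper)
  v+n≡ : v + n ≡ suc (u + (p + p))
  v+n≡ = begin
    v + n                                                  ≡⟨ cong (_+ n) v≡ ⟩
    (suc (suc (p + p)) + suc u) ∸ (n + 2) + n              ≡⟨ cong₂ (λ x y → x ∸ y + n) (e₄ p u) (+-comm n 2) ⟩
    (2 + suc (u + (p + p))) ∸ (2 + n) + n                  ≡⟨ cong (_+ n) ([m+n]∸[m+o]≡n∸o 2 (suc (u + (p + p))) n) ⟩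
    suc (u + (p + p)) ∸ n + n                              ≡⟨ m∸n+n≡m (m≤n⇒m≤1+n n≤Xlen) ⟩
    suc (u + (p + p))                                      ∎

IsG⇒Count : ∀ n v → IsG n v → ∃ λ u → FRange n u × Count n u v
IsG⇒Count n v (zero , () , _)
IsG⇒Count n v (suc u , _ , inj₁ (lower , upper , v≡)) with
  plateau (ℓ u) u n (≤-trans (s≤s z≤n) (k<ℓk u)) (subst (λ x → x + suc u ≤ n + 3) (2^suc≡1+ℓ u) lower)
                    (subst (λ x → n + 3 ≤ x + suc u + 2) (2^suc≡1+ℓ u) upper)
... | range , fits = u , range , every-residue v≡ℓ (subst (λ x → x + n ≤ suc (Xlen u)) (sym v≡ℓ) fits)
  where
  v≡ℓ : v ≡ ℓ u
  v≡ℓ = trans v≡ (cong (_∸ 1) (2^suc≡1+ℓ u))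
IsG⇒Count n v (suc u , _ , inj₂ (lower , upper , v≡)) with
  slope (ℓ u) u n v (subst (λ x → x + suc u ≤ n + 1) (2^suc≡1+ℓ u) lower)
                    (subst (λ x → n + 3 ≤ x + suc u) (2^[k+1]≡1+ℓ (suc u)) upper)
                    (trans v≡ (cong (λ x → (x + suc u) ∸ (n + 2)) (2^[k+1]≡1+ℓ (suc u))))
... | range , v≤ℓ , v+n≡ = u , range , every-window v≤ℓ v+n≡

count-below : ∀ {n j v} → Count n j v → v ≤ ℓ j
count-below (every-residue v≡ℓ _) = ≤-reflexive v≡ℓ
count-below (every-window v≤ℓ _)  = v≤ℓ

count-fits : ∀ {n j v} → Count n j v → ∀ i → i < v → i + n ≤ Xlen j
count-fits {n} (every-residue _ v+n≤) i i<v = ≤-pred (≤-trans (+-monoˡ-< n i<v) v+n≤)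
count-fits {n} (every-window _ v+n≡)  i i<v = ≤-pred (≤-trans (+-monoˡ-< n i<v) (≤-reflexive v+n≡))

-- Every window of the prefix of length Xlen j of X j equals one starting below v:
-- if v = ℓ j shift it back by the period ℓ j, otherwise it already starts below v.
count-representative : ∀ {n j v} → Count n j v → j < n → ∀ q → q + n ≤ Xlen j →
                       ∃ λ q' → q' < v × window (X j) q n ≡ window (X j) q' n
count-representative {n} {j} {v} count j<n q q+n≤Xlen with q <? v
... | yes q<v = q , q<v , refl
... | no q≮v with count
...   | every-window _ v+n≡ =
  ⊥-elim (n≮n (Xlen j) (≤-trans (≤-reflexive (sym v+n≡)) (≤-trans (+-monoˡ-≤ n (≮⇒≥ q≮v)) q+n≤Xlen)))
...   | every-residue v≡ℓ _ with m≤n⇒∃[o]m+o≡n (≤-trans (≤-reflexive (sym v≡ℓ)) (≮⇒≥ q≮v))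
...     | q' , refl = q' , subst (q' <_) (sym v≡ℓ) q'<ℓ , window-cong (X j) (X j) (ℓ j + q') q' n λ m m<n →
  trans (cong (X j) (+-assoc (ℓ j) q' m)) (X-repeat j (q' + m) (<-≤-trans (+-monoʳ-< (ℓ j) (+-monoʳ-< q' m<n)) ℓ+q'+n≤Xlen))
  where
  ℓ+q'+n≤Xlen : ℓ j + (q' + n) ≤ Xlen j
  ℓ+q'+n≤Xlen = subst (_≤ Xlen j) (+-assoc (ℓ j) q' n) q+n≤Xlen
  q'+n≤j+ℓ : q' + n ≤ j + ℓ j
  q'+n≤j+ℓ = +-cancelˡ-≤ (ℓ j) _ _ (subst (ℓ j + (q' + n) ≤_) (x∙yz≈y∙xz j (ℓ j) (ℓ j)) ℓ+q'+n≤Xlen)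
  q'<ℓ : q' < ℓ j
  q'<ℓ = +-cancelʳ-≤ j (suc q') (ℓ j)
    (subst₂ _≤_ (+-suc q' j) (+-comm j (ℓ j)) (≤-trans (+-monoʳ-≤ q' j<n) q'+n≤j+ℓ))

lemma12 : (n j v : ℕ) → 1 ≤ n → IsF n j → IsG n v →
    Σ (List (List Letter)) λ L → Unique L × length L ≡ v ×
      ((w : List Letter) → (w ∈ L) ⇔ (IsFactor w × length w ≡ n × longestBRun w ≡ j))
lemma12 n j v 1≤n isF isG with IsG⇒Count n v isG
... | u , range-u , count with FRange-unique n j u (IsF⇒FRange n j isF) range-u
... | refl = applyUpTo win v , distinct , length-applyUpTo win v , λ w → mk⇔ (counted w) (complete w)
  where
  ℓ+j≤n+1 : ℓ j + j ≤ n + 1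
  ℓ+j≤n+1 = proj₁ range-u
  j<n : j < n
  j<n = FRange⇒j<n n j 1≤n ℓ+j≤n+1
  win : ℕ → List Letter
  win i = window (X j) i n
  distinct : Unique (applyUpTo win v)
  distinct = applyUpTo⁺₁ win v λ i<i' i'<v → X-windows-distinct j n _ _ ℓ+j≤n+1 i<i' (<-≤-trans i'<v (count-below count))
  counted : ∀ w → w ∈ applyUpTo win v → IsFactor w × length w ≡ n × longestBRun w ≡ j
  counted w w∈ with ∈-applyUpTo⁻ win w∈
  ... | i , i<v , refl = X-window-counted j n i ℓ+j≤n+1 j<n (<-≤-trans i<v (count-below count)) (count-fits count i i<v)
  complete : ∀ w → IsFactor w × length w ≡ n × longestBRun w ≡ j → w ∈ applyUpTo win v
  complete w (factor , |w|≡n , longest≡j) with factor-is-X-window j n j<n w factor |w|≡n longest≡j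
  ... | q , q+n≤Xlen , refl with count-representative count j<n q q+n≤Xlen
  ...   | q' , q'<v , same = subst (_∈ applyUpTo win v) (sym same) (∈-applyUpTo⁺ win q'<v)
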